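{- Let $r\geq 3$. Then $\operatorname{Z}(C_r\circ 2K_1)=\overline{\operatorname{Z}}(C_r\circ 2K_1)=\operatorname{ZIR}(C_r\circ 2K_1)=r=\frac{1}{3}|V(C_r\circ 2K_1)|$.
   Context: For disjoint graphs $G$ (of order $n_G$) and $H$, the corona $G\circ H$ is obtained from $G$ and $n_G$ copies of $H$ by joining the $i$th vertex of $G$ to every vertex of the $i$th copy of $H$. Thus $C_r\circ 2K_1$ is the cycle $C_r$ with two pendant leaves attached to each cycle vertex. Zero forcing: from a set $B$ of blue vertices, a blue vertex $u$ may turn a white vertex $w$ blue if $w$ is the only white neighbor of $u$; $B$ is a zero forcing set if eventually all vertices are blue. $\operatorname{Z}(G)$ is the minimum size of a zero forcing set; $\overline{\operatorname{Z}}(G)$ is the maximum size of an inclusion-minimal zero forcing set. A fort is a nonempty $F\subseteq V(G)$ such that every $v\notin F$ has $|F\cap N(v)|\neq 1$. For $S\subseteq V(G)$, $x\in S$, a private fort of $x$ relative to $S$ is a fort $F$ with $S\cap F=\{x\}$; $S$ is a ZIr-set if every element has a private fort. $\operatorname{ZIR}(G)$ is the maximum cardinality of an inclusion-maximal ZIr-set of $G$. -}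

module Defs where

import Data.Nat as ℕ
open import Data.Nat using (ℕ; _+_; _*_; _≤_; _≡ᵇ_)
open import Data.Bool using (Bool; true; false; _∨_; _∧_; if_then_else_)
open import Data.Fin using (Fin; toℕ; remQuot; zero; suc)
open import Data.Fin.Subset using (Subset; _∈_; _∉_; _⊆_; _∪_; _∩_; ⁅_⁆; ⊤; ∣_∣; Nonempty)
open import Data.Product using (_×_; _,_; ∃; ∃-syntax)
open import Data.Vec using (tabulate)
open import Relation.Binary.PropositionalEquality using (_≡_; _≢_)

Graph : ℕ → Set
Graph n = Fin n → Fin n → Bool

nextMod : (r : ℕ) → Fin r → ℕ
nextMod r i = if (ℕ.suc (toℕ i) ≡ᵇ r) then 0 else ℕ.suc (toℕ i)

-- The cycle C_r on vertices 0,…,r-1 (i ~ i+1 mod r); a genuine cycle for r ≥ 3.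
cycleG : (r : ℕ) → Graph r
cycleG r i j = (toℕ j ≡ᵇ nextMod r i) ∨ (toℕ i ≡ᵇ nextMod r j)

emptyG : (m : ℕ) → Graph m
emptyG m _ _ = false

-- Corona G ∘ H.  A vertex v of Fin (n * ℕ.suc m) is decoded by remQuot as (i , j):
-- j = zero is the i-th vertex of G, j = suc a is vertex a of the i-th copy of H.
coronaAdj : {n m : ℕ} → Graph n → Graph m → Fin n × Fin (ℕ.suc m) → Fin n × Fin (ℕ.suc m) → Bool
coronaAdj G H (i , zero)  (i' , zero)  = G i i'
coronaAdj G H (i , zero)  (i' , suc b) = (toℕ i ≡ᵇ toℕ i')
coronaAdj G H (i , suc a) (i' , zero)  = (toℕ i ≡ᵇ toℕ i')
coronaAdj G H (i , suc a) (i' , suc b) = (toℕ i ≡ᵇ toℕ i') ∧ H a b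

corona : {n m : ℕ} → Graph n → Graph m → Graph (n * ℕ.suc m)
corona {n} {m} G H u v = coronaAdj G H (remQuot {n} (ℕ.suc m) u) (remQuot {n} (ℕ.suc m) v)

C∘2K1 : (r : ℕ) → Graph (r * 3)
C∘2K1 r = corona (cycleG r) (emptyG 2)

module _ {n : ℕ} (G : Graph n) where

  N : Fin n → Subset n
  N v = tabulate (λ w → G v w)

  data Reach (B : Subset n) : Subset n → Set where
    start : Reach B B
    force : ∀ {S} (u w : Fin n) → Reach B S → u ∈ S → w ∉ S → G u w ≡ true →
            (∀ x → G u x ≡ true → x ≢ w → x ∈ S) → Reach B (S ∪ ⁅ w ⁆)

  IsZFS : Subset n → Set
  IsZFS B = Reach B ⊤

  IsMinimalZFS : Subset n → Set
  IsMinimalZFS B = IsZFS B × (∀ B' → B' ⊆ B → IsZFS B' → B' ≡ B)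

  IsFort : Subset n → Set
  IsFort F = Nonempty F × (∀ v → v ∉ F → ∣ F ∩ N v ∣ ≢ 1)

  IsPrivateFort : Subset n → Fin n → Subset n → Set
  IsPrivateFort S x F = IsFort F × (S ∩ F ≡ ⁅ x ⁆)

  IsZIrSet : Subset n → Set
  IsZIrSet S = ∀ x → x ∈ S → ∃[ F ] IsPrivateFort S x F

  IsMaximalZIrSet : Subset n → Set
  IsMaximalZIrSet S = IsZIrSet S × (∀ S' → S ⊆ S' → IsZIrSet S' → S' ≡ S)

  ZIs : ℕ → Set
  ZIs k = (∃[ B ] IsZFS B × ∣ B ∣ ≡ k) × (∀ B → IsZFS B → k ≤ ∣ B ∣)

  ZbarIs : ℕ → Set
  ZbarIs k = (∃[ B ] IsMinimalZFS B × ∣ B ∣ ≡ k) × (∀ B → IsMinimalZFS B → ∣ B ∣ ≤ k)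

  ZIRIs : ℕ → Set
  ZIRIs k = (∃[ S ] IsMaximalZIrSet S × ∣ S ∣ ≡ k) × (∀ S → IsMaximalZIrSet S → ∣ S ∣ ≤ k)

-- Group the vertices of G ∘ 2K₁ into blocks {centre, two leaves}. The two leaves of a block
-- are twins, hence a fort, so every zero forcing set contains a leaf of every block; conversely
-- one chosen leaf per block forces its centre, after which each centre forces its other leaf.
-- Hence Z = Z̄ = |V(G)| for every G.
--
-- For ZIR on the cycle, let S be a ZIr-set. The private fort of a centre contains its leaves,
-- so S meets each block at most once, except for "double" blocks holding both leaves. The private
-- fort F of the first leaf of a double block v contains neither the other leaf nor the centre of v,
-- so it contains the centre of a neighbouring block, and every block whose centre lies in F misses
-- S completely. Charge v to next v if some set of such vacant blocks containing next v is closed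
-- under passing through the other double blocks, and to prev v otherwise; then no block is charged
-- twice and every charged block is vacant, so |S| ≤ r.

module Submission where

open import Defs
open import Data.Nat using (ℕ; zero; suc; _+_; _*_; _≤_; _<_; z≤n; s≤s; _≡ᵇ_)
import Data.Nat.Properties as ℕ
open import Data.Bool using (Bool; true; false; _∨_; if_then_else_)
import Data.Bool.Properties as Bool
open import Data.Product using (_×_; ∃-syntax; _,_; proj₁; proj₂; uncurry)
open import Data.Sum as Sum using (_⊎_; inj₁; inj₂; [_,_]′)
open import Data.Empty using (⊥-elim)
open import Data.Fin using (Fin; zero; suc; toℕ; fromℕ<; combine; remQuot; opposite)
open import Data.Fin.Patterns using (0F; 1F; 2F)
open import Data.Fin.Properties
  using (_≟_; any?; all?; suc-injective; toℕ-fromℕ<; toℕ-injective; toℕ<n;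
         combine-injective; combine-remQuot; remQuot-combine)
open import Data.Fin.Permutation using (Permutation′; permutation; _⟨$⟩ʳ_)
open import Data.Fin.Subset using (Subset; _∈_; _∉_; _⊆_; _⊂_; _∪_; _∩_; ⁅_⁆; ⊤; ∣_∣; Empty)
open import Data.Fin.Subset.Properties
  using (_∈?_; ∈⊤; ⊆⊤; ⊆-antisym; x∈⁅x⁆; x∈⁅y⁆⇒x≡y; ∣⁅x⁆∣≡1; ∣⊥∣≡0; Empty-unique;
         p⊆q⇒∣p∣≤∣q∣; p⊂q⇒∣p∣<∣q∣; x∈p∩q⁺; x∈p∩q⁻; x∈p∪q⁺; x∈p∪q⁻; p⊆p∪q; anySubset?)
open import Data.Vec using (tabulate; _∷_; [])
open import Data.Vec.Properties using (lookup∘tabulate; []=⇒lookup; lookup⇒[]=)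
open import Function using (_∘_; id; flip; const)
open import Function.Bundles using (Equivalence)
open import Level using (Level)
open import Relation.Nullary using (¬_; Dec; yes; no; does; proof; contradiction)
open import Relation.Nullary.Reflects using (Reflects; ofʸ; ofⁿ)
open import Relation.Nullary.Decidable using (_×-dec_; _→-dec_; ¬?; dec-true; dec-false)
open import Relation.Unary using (Pred; Decidable)
open import Relation.Binary.PropositionalEquality
  using (_≡_; _≢_; refl; sym; trans; cong; cong₂; subst; module ≡-Reasoning)
open import Algebra.Properties.CommutativeMonoid.Sum ℕ.+-0-commutativeMonoid
  using (sum; sum-cong-≗; ∑-distrib-+; sum-permute)

private
  variable
    ℓ : Level
    n : ℕ
    A B : Set ℓ

≡ᵇ-reflects : ∀ m n → Reflects (m ≡ n) (m ≡ᵇ n)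
≡ᵇ-reflects m n = proof (m ℕ.≟ n)

≡ᵇ-true⇒≡ : ∀ {m n} → (m ≡ᵇ n) ≡ true → m ≡ n
≡ᵇ-true⇒≡ {m} {n} = ℕ.≡ᵇ⇒≡ m n ∘ Equivalence.from Bool.T-≡

≡⇒≡ᵇ-true : ∀ {m n} → m ≡ n → (m ≡ᵇ n) ≡ true
≡⇒≡ᵇ-true {m} {n} = Equivalence.to Bool.T-≡ ∘ ℕ.≡⇒≡ᵇ m n

does-⇔ : (a? : Dec A) (b? : Dec B) → (A → B) → (B → A) → does a? ≡ does b?
does-⇔ (yes a) b? f _ = sym (dec-true b? (f a))
does-⇔ (no ¬a) b? _ g = sym (dec-false b? (¬a ∘ g))

𝟙 : Bool → ℕ
𝟙 true = 1
𝟙 false = 0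

𝟙-split : (a? : Dec A) (b? : Dec B) → 𝟙 (does (a? ×-dec b?)) + 𝟙 (does (a? ×-dec ¬? b?)) ≡ 𝟙 (does a?)
𝟙-split (yes _) (yes _) = refl
𝟙-split (yes _) (no _) = refl
𝟙-split (no _) _ = refl

sum-mono : ∀ {k} {f g : Fin k → ℕ} → (∀ i → f i ≤ g i) → sum f ≤ sum g
sum-mono {zero} _ = z≤n
sum-mono {suc k} f≤g = ℕ.+-mono-≤ (f≤g zero) (sum-mono (f≤g ∘ suc))

sum-ones : ∀ k → sum {k} (λ _ → 1) ≡ k
sum-ones zero = refl
sum-ones (suc k) = cong suc (sum-ones k)

sum-≤-by-discharging : ∀ {k} (σ τ : Permutation′ k) (c e g h : Fin k → ℕ) →
                       (∀ i → c i + (g (σ ⟨$⟩ʳ i) + h (τ ⟨$⟩ʳ i)) ≤ e i + (g i + h i)) →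
                       sum c ≤ sum e
sum-≤-by-discharging σ τ c e g h local = ℕ.+-cancelʳ-≤ (sum g + sum h) (sum c) (sum e) (begin
  sum c + (sum g + sum h)
    ≡⟨ cong (sum c +_) (cong₂ _+_ (sum-permute g σ) (sum-permute h τ)) ⟩
  sum c + (sum (λ i → g (σ ⟨$⟩ʳ i)) + sum (λ i → h (τ ⟨$⟩ʳ i)))
    ≡⟨ cong (sum c +_) (sym (∑-distrib-+ (λ i → g (σ ⟨$⟩ʳ i)) (λ i → h (τ ⟨$⟩ʳ i)))) ⟩
  sum c + sum (λ i → g (σ ⟨$⟩ʳ i) + h (τ ⟨$⟩ʳ i))
    ≡⟨ sym (∑-distrib-+ c (λ i → g (σ ⟨$⟩ʳ i) + h (τ ⟨$⟩ʳ i))) ⟩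
  sum (λ i → c i + (g (σ ⟨$⟩ʳ i) + h (τ ⟨$⟩ʳ i)))
    ≤⟨ sum-mono local ⟩
  sum (λ i → e i + (g i + h i))
    ≡⟨ ∑-distrib-+ e (λ i → g i + h i) ⟩
  sum e + sum (λ i → g i + h i)
    ≡⟨ cong (sum e +_) (∑-distrib-+ g h) ⟩
  sum e + (sum g + sum h) ∎)
  where open ℕ.≤-Reasoning

∈-tabulate⁺ : ∀ {f : Fin n → Bool} {x} → f x ≡ true → x ∈ tabulate f
∈-tabulate⁺ {f = f} {x} fx = lookup⇒[]= x (tabulate f) (trans (lookup∘tabulate f x) fx)

∈-tabulate⁻ : ∀ {f : Fin n → Bool} {x} → x ∈ tabulate f → f x ≡ true
∈-tabulate⁻ {f = f} {x} x∈ = trans (sym (lookup∘tabulate f x)) ([]=⇒lookup x∈)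

subset : {P : Pred (Fin n) ℓ} → Decidable P → Subset n
subset P? = tabulate (λ x → does (P? x))

module _ {P : Pred (Fin n) ℓ} {P? : Decidable P} {x : Fin n} where

  ∈-subset⁺ : P x → x ∈ subset P?
  ∈-subset⁺ px = ∈-tabulate⁺ (dec-true (P? x) px)

  ∈-subset⁻ : x ∈ subset P? → P x
  ∈-subset⁻ x∈ with P? x | ∈-tabulate⁻ {f = λ y → does (P? y)} x∈
  ... | yes px | _ = px

p⊆q∧∣q∣≤∣p∣⇒q≡p : ∀ {p q : Subset n} → p ⊆ q → ∣ q ∣ ≤ ∣ p ∣ → q ≡ p
p⊆q∧∣q∣≤∣p∣⇒q≡p {p = p} {q} p⊆q ∣q∣≤∣p∣ = ⊆-antisym q⊆p p⊆q
  where
  q⊆p : q ⊆ p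
  q⊆p {x} x∈q with x ∈? p
  ... | yes x∈p = x∈p
  ... | no x∉p = contradiction (p⊂q⇒∣p∣<∣q∣ (p⊆q , x , x∈q , x∉p)) (ℕ.≤⇒≯ ∣q∣≤∣p∣)

module _ {S F : Subset n} {x : Fin n} (S∩F≡⁅x⁆ : S ∩ F ≡ ⁅ x ⁆) where

  private-fort-∋ : x ∈ F
  private-fort-∋ = proj₂ (x∈p∩q⁻ S F (subst (x ∈_) (sym S∩F≡⁅x⁆) (x∈⁅x⁆ x)))

  private-fort-unique : ∀ {y} → y ∈ S → y ∈ F → y ≡ x
  private-fort-unique y∈S y∈F = x∈⁅y⁆⇒x≡y x (subst (_ ∈_) S∩F≡⁅x⁆ (x∈p∩q⁺ (y∈S , y∈F)))

module _ (G : Graph n) where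

  ∈N⁺ : ∀ {v x} → G v x ≡ true → x ∈ N G v
  ∈N⁺ = ∈-tabulate⁺

  ∈N⁻ : ∀ {v x} → x ∈ N G v → G v x ≡ true
  ∈N⁻ = ∈-tabulate⁻

  fort-second-neighbour : ∀ {F v p} → IsFort G F → v ∉ F → p ∈ F → G v p ≡ true →
                          ∃[ x ] G v x ≡ true × x ≢ p × x ∈ F
  fort-second-neighbour {F} {v} {p} (_ , notOne) v∉F p∈F vp
    with any? (λ x → (G v x Bool.≟ true) ×-dec ¬? (x ≟ p) ×-dec (x ∈? F))
  ... | yes found = found
  ... | no none = ⊥-elim (notOne v v∉F (trans (cong ∣_∣ F∩Nv≡⁅p⁆) (∣⁅x⁆∣≡1 p)))
    where
    F∩Nv⊆⁅p⁆ : F ∩ N G v ⊆ ⁅ p ⁆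
    F∩Nv⊆⁅p⁆ {x} x∈ with x ≟ p | x∈p∩q⁻ F (N G v) x∈
    ... | yes refl | _ = x∈⁅x⁆ p
    ... | no x≢p | x∈F , x∈N = contradiction (x , ∈N⁻ x∈N , x≢p , x∈F) none

    F∩Nv≡⁅p⁆ : F ∩ N G v ≡ ⁅ p ⁆
    F∩Nv≡⁅p⁆ = ⊆-antisym F∩Nv⊆⁅p⁆ λ x∈⁅p⁆ →
      subst (_∈ F ∩ N G v) (sym (x∈⁅y⁆⇒x≡y p x∈⁅p⁆)) (x∈p∩q⁺ (p∈F , ∈N⁺ vp))

  twins-fort : ∀ {u w} → u ≢ w → (∀ x → G x u ≡ G x w) → IsFort G (⁅ u ⁆ ∪ ⁅ w ⁆)
  twins-fort {u} {w} u≢w twins = (u , u∈P) , notOne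
    where
    P = ⁅ u ⁆ ∪ ⁅ w ⁆
    u∈P = x∈p∪q⁺ (inj₁ (x∈⁅x⁆ u))
    w∈P = x∈p∪q⁺ (inj₂ (x∈⁅x⁆ w))

    adj-P : ∀ x {y} → y ∈ P → G x y ≡ G x u
    adj-P x y∈P with x∈p∪q⁻ ⁅ u ⁆ ⁅ w ⁆ y∈P
    ... | inj₁ y∈⁅u⁆ = cong (G x) (x∈⁅y⁆⇒x≡y u y∈⁅u⁆)
    ... | inj₂ y∈⁅w⁆ = trans (cong (G x) (x∈⁅y⁆⇒x≡y w y∈⁅w⁆)) (sym (twins x))

    notOne : ∀ x → x ∉ P → ∣ P ∩ N G x ∣ ≢ 1
    notOne x _ with G x u in xu
    ... | true = ℕ.<⇒≢ (subst (_< ∣ P ∩ N G x ∣) (∣⁅x⁆∣≡1 u) (p⊂q⇒∣p∣<∣q∣ ⁅u⁆⊂P∩Nx)) ∘ sym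
      where
      ⁅u⁆⊆P∩Nx : ⁅ u ⁆ ⊆ P ∩ N G x
      ⁅u⁆⊆P∩Nx y∈⁅u⁆ = subst (_∈ P ∩ N G x) (sym (x∈⁅y⁆⇒x≡y u y∈⁅u⁆)) (x∈p∩q⁺ (u∈P , ∈N⁺ xu))

      ⁅u⁆⊂P∩Nx : ⁅ u ⁆ ⊂ P ∩ N G x
      ⁅u⁆⊂P∩Nx = ⁅u⁆⊆P∩Nx , w , x∈p∩q⁺ (w∈P , ∈N⁺ (trans (adj-P x w∈P) xu)) ,
                 λ w∈⁅u⁆ → u≢w (sym (x∈⁅y⁆⇒x≡y u w∈⁅u⁆))
    ... | false = λ ∣P∩Nx∣≡1 → contradiction (trans ∣P∩Nx∣≡0 ∣P∩Nx∣≡1) λ ()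
      where
      empty : Empty (P ∩ N G x)
      empty (y , y∈) =
        let y∈P , y∈N = x∈p∩q⁻ P (N G x) y∈
        in contradiction (trans (sym (∈N⁻ y∈N)) (trans (adj-P x y∈P) xu)) λ ()

      ∣P∩Nx∣≡0 : 0 ≡ ∣ P ∩ N G x ∣
      ∣P∩Nx∣≡0 = trans (sym (∣⊥∣≡0 n)) (cong ∣_∣ (sym (Empty-unique empty)))

  reach-avoids-fort : ∀ {B S F} → Reach G B S → IsFort G F →
                      (∀ {x} → x ∈ F → x ∉ B) → ∀ {x} → x ∈ F → x ∉ S
  reach-avoids-fort start _ avoid = avoid
  reach-avoids-fort (force u w reach u∈S w∉S uw others) fort avoid x∈F x∈S∪⁅w⁆
    with x∈p∪q⁻ _ ⁅ w ⁆ x∈S∪⁅w⁆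
  ... | inj₁ x∈S = reach-avoids-fort reach fort avoid x∈F x∈S
  ... | inj₂ x∈⁅w⁆
    with fort-second-neighbour fort (λ u∈F → reach-avoids-fort reach fort avoid u∈F u∈S)
                               (subst (_∈ _) (x∈⁅y⁆⇒x≡y w x∈⁅w⁆) x∈F) uw
  ...   | y , uy , y≢w , y∈F = reach-avoids-fort reach fort avoid y∈F (others y uy y≢w)

  zfs-meets-fort : ∀ {B F} → IsZFS G B → IsFort G F → ¬ (∀ {x} → x ∈ F → x ∉ B)
  zfs-meets-fort zfs fort@((x , x∈F) , _) avoid = reach-avoids-fort zfs fort avoid x∈F ∈⊤

  Forceable : Subset n → Fin n → Set
  Forceable S w = ∃[ u ] u ∈ S × G u w ≡ true × (∀ x → G u x ≡ true → x ≢ w → x ∈ S)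

  forceable-mono : ∀ {S T w} → S ⊆ T → Forceable S w → Forceable T w
  forceable-mono S⊆T (u , u∈S , uw , others) = u , S⊆T u∈S , uw , λ x ux x≢w → S⊆T (others x ux x≢w)

  force-all : ∀ {k B S} (ws : Fin k → Fin n) → Reach G B S → (∀ i → Forceable S (ws i)) →
              ∃[ T ] Reach G B T × S ⊆ T × (∀ i → ws i ∈ T)
  force-all {zero} ws reach _ = _ , reach , id , λ ()
  force-all {suc k} {S = S} ws reach forceable with ws zero ∈? S
  ... | yes w∈S =
    let T , reachT , S⊆T , ws∈T = force-all (ws ∘ suc) reach (forceable ∘ suc)
    in T , reachT , S⊆T , λ { zero → S⊆T w∈S ; (suc i) → ws∈T i }
  ... | no w∉S =
    let u , u∈S , uw , others = forceable zero
        S⊆S′ = p⊆p∪q ⁅ ws zero ⁆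
        T , reachT , S′⊆T , ws∈T = force-all (ws ∘ suc) (force u (ws zero) reach u∈S w∉S uw others)
                                             (forceable-mono S⊆S′ ∘ forceable ∘ suc)
    in T , reachT , S′⊆T ∘ S⊆S′ ,
       λ { zero → S′⊆T (x∈p∪q⁺ (inj₂ (x∈⁅x⁆ (ws zero)))) ; (suc i) → ws∈T i }

blockSize : ∀ {k} → Subset (k * 3) → Fin k → ℕ
blockSize S i = sum (λ j → 𝟙 (does (combine i j ∈? S)))

∣∣≡∑blockSize : ∀ {k} (S : Subset (k * 3)) → ∣ S ∣ ≡ sum (blockSize {k} S)
∣∣≡∑blockSize {zero} [] = refl
∣∣≡∑blockSize {suc k} (a ∷ b ∷ c ∷ S) = begin
  ∣ a ∷ b ∷ c ∷ S ∣                      ≡⟨ ∣∷∣ a _ ⟩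
  α + ∣ b ∷ c ∷ S ∣                      ≡⟨ cong (α +_) (∣∷∣ b _) ⟩
  α + (β + ∣ c ∷ S ∣)                    ≡⟨ cong (λ s → α + (β + s)) (∣∷∣ c S) ⟩
  α + (β + (γ + ∣ S ∣))                  ≡⟨ cong (λ s → α + (β + (γ + s))) (∣∣≡∑blockSize {k} S) ⟩
  α + (β + (γ + Σ))                      ≡⟨ cong (λ s → α + (β + s)) (sym (ℕ.+-assoc γ 0 Σ)) ⟩
  α + (β + ((γ + 0) + Σ))                ≡⟨ cong (α +_) (sym (ℕ.+-assoc β (γ + 0) Σ)) ⟩
  α + ((β + (γ + 0)) + Σ)                ≡⟨ sym (ℕ.+-assoc α (β + (γ + 0)) Σ) ⟩
  sum (blockSize {suc k} (a ∷ b ∷ c ∷ S)) ∎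
  where
  open ≡-Reasoning
  ∣∷∣ : ∀ {n} x (p : Subset n) → ∣ x ∷ p ∣ ≡ 𝟙 (does (zero ∈? x ∷ p)) + ∣ p ∣
  ∣∷∣ true p = refl
  ∣∷∣ false p = refl
  α = 𝟙 (does (zero ∈? a ∷ b ∷ c ∷ S))
  β = 𝟙 (does (zero ∈? b ∷ c ∷ S))
  γ = 𝟙 (does (zero ∈? c ∷ S))
  Σ = sum (blockSize {k} S)

blockSize-vacant : ∀ {k} {S : Subset (k * 3)} {i : Fin k} → (∀ j → combine i j ∉ S) → blockSize S i ≡ 0
blockSize-vacant {S = S} {i} vacant =
  sum-cong-≗ {3} (λ j → cong 𝟙 (dec-false (combine i j ∈? S) (vacant j)))

-- Stated in the shape blockSize unfolds to (a sum over Fin 3 ends in + 0).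
𝟙-block≤ : ∀ {C L₀ L₁ : Set} (c? : Dec C) (l₀? : Dec L₀) (l₁? : Dec L₁) →
           (C → ¬ L₀) → (C → ¬ L₁) →
           𝟙 (does c?) + (𝟙 (does l₀?) + (𝟙 (does l₁?) + 0)) ≤ 1 + 𝟙 (does (l₀? ×-dec l₁?))
𝟙-block≤ (yes c) (yes l₀) _ c⇒¬l₀ _ = contradiction l₀ (c⇒¬l₀ c)
𝟙-block≤ (yes c) (no _) (yes l₁) _ c⇒¬l₁ = contradiction l₁ (c⇒¬l₁ c)
𝟙-block≤ (yes _) (no _) (no _) _ _ = ℕ.≤-refl
𝟙-block≤ (no _) (yes _) (yes _) _ _ = ℕ.≤-refl
𝟙-block≤ (no _) (yes _) (no _) _ _ = ℕ.≤-refl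
𝟙-block≤ (no _) (no _) (yes _) _ _ = ℕ.≤-refl
𝟙-block≤ (no _) (no _) (no _) _ _ = z≤n

≡⊎≡opposite : ∀ (a b : Fin 2) → b ≡ a ⊎ b ≡ opposite a
≡⊎≡opposite 0F 0F = inj₁ refl
≡⊎≡opposite 0F 1F = inj₂ refl
≡⊎≡opposite 1F 0F = inj₂ refl
≡⊎≡opposite 1F 1F = inj₁ refl

module Corona₂ {k : ℕ} (G : Graph k) where

  G∘2K1 : Graph (k * 3)
  G∘2K1 = corona G (emptyG 2)

  centre : Fin k → Fin (k * 3)
  centre i = combine i 0F

  leaf : Fin k → Fin 2 → Fin (k * 3)
  leaf i a = combine i (suc a)

  data Vertex : Fin (k * 3) → Set where
    centreᵛ : ∀ i → Vertex (centre i)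
    leafᵛ : ∀ i a → Vertex (leaf i a)

  vertex : ∀ x → Vertex x
  vertex x = subst Vertex (combine-remQuot {k} 3 x) (decode (remQuot {k} 3 x))
    where
    decode : ∀ ij → Vertex (uncurry combine ij)
    decode (i , zero) = centreᵛ i
    decode (i , suc a) = leafᵛ i a

  leaf≢centre : ∀ {i j a} → leaf i a ≢ centre j
  leaf≢centre {i} {j} {a} e with () ← proj₂ (combine-injective i (suc a) j 0F e)

  leaf-injective : ∀ {i j a b} → leaf i a ≡ leaf j b → i ≡ j × a ≡ b
  leaf-injective {i} {j} {a} {b} e with refl , refl ← combine-injective i (suc a) j (suc b) e = refl , refl

  adjacency : ∀ i j i′ j′ →
              G∘2K1 (combine i j) (combine i′ j′) ≡ coronaAdj G (emptyG 2) (i , j) (i′ , j′)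
  adjacency i j i′ j′ = cong₂ (coronaAdj G (emptyG 2)) (remQuot-combine i j) (remQuot-combine i′ j′)

  private
    toℕ-≡ᵇ⇒≡ : ∀ {i j : Fin k} → (toℕ i ≡ᵇ toℕ j) ≡ true → i ≡ j
    toℕ-≡ᵇ⇒≡ = toℕ-injective ∘ ≡ᵇ-true⇒≡

  centre-adj-centre : ∀ i j → G∘2K1 (centre i) (centre j) ≡ G i j
  centre-adj-centre i j = adjacency i 0F j 0F

  centre-adj-leaf : ∀ {i a} → G∘2K1 (centre i) (leaf i a) ≡ true
  centre-adj-leaf {i} {a} = trans (adjacency i 0F i (suc a)) (≡⇒≡ᵇ-true {toℕ i} refl)

  leaf-adj-centre : ∀ {i a} → G∘2K1 (leaf i a) (centre i) ≡ true
  leaf-adj-centre {i} {a} = trans (adjacency i (suc a) i 0F) (≡⇒≡ᵇ-true {toℕ i} refl)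

  leaf-adj⇒ : ∀ {i a x} → G∘2K1 (leaf i a) x ≡ true → x ≡ centre i
  leaf-adj⇒ {i} {a} {x} e with vertex x
  ... | centreᵛ j = cong centre (sym (toℕ-≡ᵇ⇒≡ (trans (sym (adjacency i (suc a) j 0F)) e)))
  ... | leafᵛ j b =
    contradiction (trans (sym (trans (adjacency i (suc a) j (suc b)) (Bool.∧-zeroʳ _))) e) λ ()

  centre-adj⇒ : ∀ {i x} → G∘2K1 (centre i) x ≡ true →
                (∃[ j ] G i j ≡ true × x ≡ centre j) ⊎ (∃[ a ] x ≡ leaf i a)
  centre-adj⇒ {i} {x} e with vertex x
  ... | centreᵛ j = inj₁ (j , trans (sym (centre-adj-centre i j)) e , refl)
  ... | leafᵛ j a =
    inj₂ (a , cong (λ j → leaf j a) (sym (toℕ-≡ᵇ⇒≡ (trans (sym (adjacency i 0F j (suc a))) e))))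

  leaf-twins : ∀ {i} x → G∘2K1 x (leaf i 0F) ≡ G∘2K1 x (leaf i 1F)
  leaf-twins {i} x with vertex x
  ... | centreᵛ j = trans (adjacency j 0F i 1F) (sym (adjacency j 0F i 2F))
  ... | leafᵛ j a = trans (adjacency j (suc a) i 1F) (sym (adjacency j (suc a) i 2F))

  leafPair : Fin k → Subset (k * 3)
  leafPair i = ⁅ leaf i 0F ⁆ ∪ ⁅ leaf i 1F ⁆

  leafPair-∈⁻ : ∀ {i x} → x ∈ leafPair i → ∃[ a ] x ≡ leaf i a
  leafPair-∈⁻ {i} x∈ = [ (λ x∈₀ → 0F , x∈⁅y⁆⇒x≡y _ x∈₀) , (λ x∈₁ → 1F , x∈⁅y⁆⇒x≡y _ x∈₁) ]′
                         (x∈p∪q⁻ ⁅ leaf i 0F ⁆ ⁅ leaf i 1F ⁆ x∈)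

  leafPair-∋ : ∀ {i} a → leaf i a ∈ leafPair i
  leafPair-∋ 0F = x∈p∪q⁺ (inj₁ (x∈⁅x⁆ _))
  leafPair-∋ 1F = x∈p∪q⁺ (inj₂ (x∈⁅x⁆ _))

  leafPair-fort : ∀ i → IsFort G∘2K1 (leafPair i)
  leafPair-fort i = twins-fort G∘2K1 (λ e → contradiction (proj₂ (leaf-injective e)) λ ()) leaf-twins

  fort-centre⇒leaf : ∀ {F i a} → IsFort G∘2K1 F → centre i ∈ F → leaf i a ∈ F
  fort-centre⇒leaf {F} {i} {a} fort c∈F with leaf i a ∈? F
  ... | yes l∈F = l∈F
  ... | no l∉F =
    let x , lx , x≢c , _ = fort-second-neighbour G∘2K1 fort l∉F c∈F leaf-adj-centre
    in contradiction (leaf-adj⇒ lx) x≢c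

  fort-centre⇒block : ∀ {F i} → IsFort G∘2K1 F → centre i ∈ F → ∀ j → combine i j ∈ F
  fort-centre⇒block fort c∈F zero = c∈F
  fort-centre⇒block fort c∈F (suc a) = fort-centre⇒leaf fort c∈F

  zfs-∋-leaf : ∀ {B} → IsZFS G∘2K1 B → ∀ i → ∃[ a ] leaf i a ∈ B
  zfs-∋-leaf {B} zfs i with leaf i 0F ∈? B | leaf i 1F ∈? B
  ... | yes l₀∈B | _ = 0F , l₀∈B
  ... | no _ | yes l₁∈B = 1F , l₁∈B
  ... | no l₀∉B | no l₁∉B = ⊥-elim (zfs-meets-fort G∘2K1 zfs (leafPair-fort i) avoid)
    where
    leaf∉B : ∀ a → leaf i a ∉ B
    leaf∉B 0F = l₀∉B
    leaf∉B 1F = l₁∉B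

    avoid : ∀ {x} → x ∈ leafPair i → x ∉ B
    avoid x∈ with leafPair-∈⁻ x∈
    ... | a , refl = leaf∉B a

  IsChosenLeaf : (Fin k → Fin 2) → Fin (k * 3) → Set
  IsChosenLeaf c x = ∃[ i ] x ≡ leaf i (c i)

  isChosenLeaf? : ∀ c → Decidable (IsChosenLeaf c)
  isChosenLeaf? c x = any? (λ i → x ≟ leaf i (c i))

  leaves : (Fin k → Fin 2) → Subset (k * 3)
  leaves c = subset (isChosenLeaf? c)

  leaves-∋ : ∀ c i → leaf i (c i) ∈ leaves c
  leaves-∋ c i = ∈-subset⁺ {P? = isChosenLeaf? c} (i , refl)

  leaves-∈⁻ : ∀ {c x} → x ∈ leaves c → IsChosenLeaf c x
  leaves-∈⁻ {c} = ∈-subset⁻ {P? = isChosenLeaf? c}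

  combine∈leaves⇒ : ∀ {c i j} → combine i j ∈ leaves c → j ≡ suc (c i)
  combine∈leaves⇒ {c} {i} {j} x∈ with leaves-∈⁻ x∈
  ... | i′ , e with refl , refl ← combine-injective i j i′ (suc (c i′)) e = refl

  leaf∈leaves⇒ : ∀ {c i a} → leaf i a ∈ leaves c → a ≡ c i
  leaf∈leaves⇒ = suc-injective ∘ combine∈leaves⇒

  ∣leaves∣ : ∀ c → ∣ leaves c ∣ ≡ k
  ∣leaves∣ c = begin
    ∣ leaves c ∣                                        ≡⟨ ∣∣≡∑blockSize {k} (leaves c) ⟩
    sum (blockSize {k} (leaves c))                      ≡⟨ sum-cong-≗ {k} (sum-cong-≗ {3} ∘ member) ⟩
    sum (λ i → sum (λ j → 𝟙 (does (j ≟ suc (c i)))))   ≡⟨ sum-cong-≗ {k} (λ i → single (c i)) ⟩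
    sum {k} (λ _ → 1)                                   ≡⟨ sum-ones k ⟩
    k                                                   ∎
    where
    open ≡-Reasoning
    member : ∀ i j → 𝟙 (does (combine i j ∈? leaves c)) ≡ 𝟙 (does (j ≟ suc (c i)))
    member i j = cong 𝟙 (does-⇔ (combine i j ∈? leaves c) (j ≟ suc (c i)) combine∈leaves⇒
                                (λ { refl → leaves-∋ c i }))
    single : ∀ a → sum (λ j → 𝟙 (does (j ≟ suc a))) ≡ 1
    single 0F = refl
    single 1F = refl

  leaves-zfs : ∀ c → IsZFS G∘2K1 (leaves c)
  leaves-zfs c =
    let T₁ , reach₁ , leaves⊆T₁ , centres∈T₁ = force-all G∘2K1 centre start centre-forceable
        T₂ , reach₂ , T₁⊆T₂ , others∈T₂ =
          force-all G∘2K1 other reach₁ (other-forceable leaves⊆T₁ centres∈T₁)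
    in subst (Reach G∘2K1 (leaves c))
             (⊆-antisym ⊆⊤ (covered (T₁⊆T₂ ∘ leaves⊆T₁) (T₁⊆T₂ ∘ centres∈T₁) others∈T₂)) reach₂
    where
    other : Fin k → Fin (k * 3)
    other i = leaf i (opposite (c i))

    centre-forceable : ∀ i → Forceable G∘2K1 (leaves c) (centre i)
    centre-forceable i = leaf i (c i) , leaves-∋ c i , leaf-adj-centre ,
                         λ x lx x≢c → contradiction (leaf-adj⇒ lx) x≢c

    other-forceable : ∀ {T} → leaves c ⊆ T → (∀ i → centre i ∈ T) → ∀ i → Forceable G∘2K1 T (other i)
    other-forceable {T} leaves⊆T centres∈T i = centre i , centres∈T i , centre-adj-leaf , others
      where
      others : ∀ x → G∘2K1 (centre i) x ≡ true → x ≢ other i → x ∈ T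
      others x cx x≢o with centre-adj⇒ cx
      ... | inj₁ (j , _ , refl) = centres∈T j
      ... | inj₂ (a , refl) with ≡⊎≡opposite (c i) a
      ...   | inj₁ refl = leaves⊆T (leaves-∋ c i)
      ...   | inj₂ refl = contradiction refl x≢o

    covered : ∀ {T} → leaves c ⊆ T → (∀ i → centre i ∈ T) → (∀ i → other i ∈ T) → ∀ {x} → x ∈ ⊤ → x ∈ T
    covered leaves⊆T centres∈T others∈T {x} _ with vertex x
    ... | centreᵛ i = centres∈T i
    ... | leafᵛ i a with ≡⊎≡opposite (c i) a
    ...   | inj₁ refl = leaves⊆T (leaves-∋ c i)
    ...   | inj₂ refl = others∈T i

  zfs-⊇-leaves : ∀ {B} → IsZFS G∘2K1 B → ∃[ c ] leaves c ⊆ B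
  zfs-⊇-leaves {B} zfs = c , leaves⊆B
    where
    c : Fin k → Fin 2
    c i = proj₁ (zfs-∋-leaf zfs i)

    leaves⊆B : leaves c ⊆ B
    leaves⊆B x∈ with leaves-∈⁻ x∈
    ... | i , refl = proj₂ (zfs-∋-leaf zfs i)

  leaves-minimal : ∀ c → IsMinimalZFS G∘2K1 (leaves c)
  leaves-minimal c = leaves-zfs c , λ B B⊆ zfs → ⊆-antisym B⊆ (⊆B zfs B⊆)
    where
    ⊆B : ∀ {B} → IsZFS G∘2K1 B → B ⊆ leaves c → leaves c ⊆ B
    ⊆B zfs B⊆ x∈ with leaves-∈⁻ x∈
    ... | i , refl with zfs-∋-leaf zfs i
    ...   | a , l∈B with refl ← leaf∈leaves⇒ (B⊆ l∈B) = l∈B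

  Z-G∘2K1 : ZIs G∘2K1 k
  Z-G∘2K1 = (leaves (const 0F) , leaves-zfs (const 0F) , ∣leaves∣ (const 0F)) , λ B zfs →
    let c , leaves⊆B = zfs-⊇-leaves zfs
    in subst (_≤ ∣ B ∣) (∣leaves∣ c) (p⊆q⇒∣p∣≤∣q∣ leaves⊆B)

  Zbar-G∘2K1 : ZbarIs G∘2K1 k
  Zbar-G∘2K1 = (leaves (const 0F) , leaves-minimal (const 0F) , ∣leaves∣ (const 0F)) , λ B (zfs , minimal) →
    let c , leaves⊆B = zfs-⊇-leaves zfs
    in ℕ.≤-reflexive (trans (cong ∣_∣ (sym (minimal (leaves c) leaves⊆B (leaves-zfs c)))) (∣leaves∣ c))

  leaves-ZIr : ∀ c → IsZIrSet G∘2K1 (leaves c)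
  leaves-ZIr c x x∈ with leaves-∈⁻ x∈
  ... | i , refl = leafPair i , leafPair-fort i , ⊆-antisym ⊆⁅l⁆ ⁅l⁆⊆
    where
    ⊆⁅l⁆ : leaves c ∩ leafPair i ⊆ ⁅ leaf i (c i) ⁆
    ⊆⁅l⁆ y∈ with x∈p∩q⁻ (leaves c) (leafPair i) y∈
    ... | y∈leaves , y∈pair with leafPair-∈⁻ y∈pair
    ...   | a , refl with refl ← leaf∈leaves⇒ y∈leaves = x∈⁅x⁆ _
    ⁅l⁆⊆ : ⁅ leaf i (c i) ⁆ ⊆ leaves c ∩ leafPair i
    ⁅l⁆⊆ y∈ rewrite x∈⁅y⁆⇒x≡y _ y∈ = x∈p∩q⁺ (leaves-∋ c i , leafPair-∋ (c i))

  ZIr-centre⇒leaf∉ : ∀ {S i a} → IsZIrSet G∘2K1 S → centre i ∈ S → leaf i a ∉ S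
  ZIr-centre⇒leaf∉ zir c∈S l∈S =
    let F , fort , S∩F≡ = zir _ c∈S
    in leaf≢centre (private-fort-unique S∩F≡ l∈S (fort-centre⇒leaf fort (private-fort-∋ S∩F≡)))

  Double : Subset (k * 3) → Fin k → Set
  Double S i = leaf i 0F ∈ S × leaf i 1F ∈ S

  double? : ∀ S → Decidable (Double S)
  double? S i = (leaf i 0F ∈? S) ×-dec (leaf i 1F ∈? S)

  ZIr-blockSize≤ : ∀ {S} → IsZIrSet G∘2K1 S → ∀ i → blockSize S i ≤ 1 + 𝟙 (does (double? S i))
  ZIr-blockSize≤ {S} zir i =
    𝟙-block≤ (centre i ∈? S) (leaf i 0F ∈? S) (leaf i 1F ∈? S) (ZIr-centre⇒leaf∉ zir) (ZIr-centre⇒leaf∉ zir)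

module Cycle (m : ℕ) where

  r : ℕ
  r = 3 + m

  nextℕ : ℕ → ℕ
  nextℕ i = if suc i ≡ᵇ r then 0 else suc i

  prevℕ : ℕ → ℕ
  prevℕ zero = 2 + m
  prevℕ (suc i) = i

  nextℕ<r : ∀ {i} → i < r → nextℕ i < r
  nextℕ<r {i} i<r with suc i ≡ᵇ r | ≡ᵇ-reflects (suc i) r
  ... | true | _ = s≤s z≤n
  ... | false | ofⁿ 1+i≢r = ℕ.≤∧≢⇒< i<r 1+i≢r

  prevℕ<r : ∀ {i} → i < r → prevℕ i < r
  prevℕ<r {zero} _ = ℕ.n<1+n _
  prevℕ<r {suc i} (s≤s i<) = ℕ.m≤n⇒m≤1+n i<

  nextℕ-prevℕ : ∀ {i} → i < r → nextℕ (prevℕ i) ≡ i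
  nextℕ-prevℕ {zero} _ with r ≡ᵇ r | ≡ᵇ-reflects r r
  ... | true | _ = refl
  ... | false | ofⁿ r≢r = contradiction refl r≢r
  nextℕ-prevℕ {suc i} 1+i<r with suc i ≡ᵇ r | ≡ᵇ-reflects (suc i) r
  ... | true | ofʸ 1+i≡r = contradiction 1+i≡r (ℕ.<⇒≢ 1+i<r)
  ... | false | _ = refl

  prevℕ-nextℕ : ∀ i → prevℕ (nextℕ i) ≡ i
  prevℕ-nextℕ i with suc i ≡ᵇ r | ≡ᵇ-reflects (suc i) r
  ... | true | ofʸ 1+i≡r = sym (ℕ.suc-injective 1+i≡r)
  ... | false | _ = refl

  nextℕ²≢id : ∀ i → nextℕ (nextℕ i) ≢ i
  nextℕ²≢id i with suc i ≡ᵇ r | ≡ᵇ-reflects (suc i) r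
  ... | true | ofʸ 1+i≡r = λ { refl → contradiction 1+i≡r λ () }
  ... | false | _ with suc (suc i) ≡ᵇ r | ≡ᵇ-reflects (suc (suc i)) r
  ...   | true | ofʸ 2+i≡r = λ { refl → contradiction 2+i≡r λ () }
  ...   | false | _ = ℕ.<⇒≢ (ℕ.m≤n⇒m≤1+n (ℕ.n<1+n i)) ∘ sym

  next : Fin r → Fin r
  next i = fromℕ< (nextℕ<r (toℕ<n i))

  prev : Fin r → Fin r
  prev i = fromℕ< (prevℕ<r (toℕ<n i))

  toℕ-next : ∀ i → toℕ (next i) ≡ nextMod r i
  toℕ-next i = toℕ-fromℕ< _

  toℕ-prev : ∀ i → toℕ (prev i) ≡ prevℕ (toℕ i)
  toℕ-prev i = toℕ-fromℕ< _

  next-prev : ∀ i → next (prev i) ≡ i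
  next-prev i = toℕ-injective (begin
    toℕ (next (prev i))     ≡⟨ toℕ-next (prev i) ⟩
    nextℕ (toℕ (prev i))    ≡⟨ cong nextℕ (toℕ-prev i) ⟩
    nextℕ (prevℕ (toℕ i))   ≡⟨ nextℕ-prevℕ (toℕ<n i) ⟩
    toℕ i                   ∎)
    where open ≡-Reasoning

  prev-next : ∀ i → prev (next i) ≡ i
  prev-next i = toℕ-injective (begin
    toℕ (prev (next i))     ≡⟨ toℕ-prev (next i) ⟩
    prevℕ (toℕ (next i))    ≡⟨ cong prevℕ (toℕ-next i) ⟩
    prevℕ (nextℕ (toℕ i))   ≡⟨ prevℕ-nextℕ (toℕ i) ⟩
    toℕ i                   ∎)
    where open ≡-Reasoning

  next≢prev : ∀ i → next i ≢ prev i
  next≢prev i e = nextℕ²≢id (toℕ i) (begin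
    nextℕ (nextℕ (toℕ i))   ≡⟨ cong nextℕ (sym (toℕ-next i)) ⟩
    nextℕ (toℕ (next i))    ≡⟨ sym (toℕ-next (next i)) ⟩
    toℕ (next (next i))     ≡⟨ cong (toℕ ∘ next) e ⟩
    toℕ (next (prev i))     ≡⟨ cong toℕ (next-prev i) ⟩
    toℕ i                   ∎)
    where open ≡-Reasoning

  adj-next : ∀ i → cycleG r i (next i) ≡ true
  adj-next i = cong (_∨ (toℕ i ≡ᵇ nextMod r (next i))) (≡⇒≡ᵇ-true (toℕ-next i))

  adj-prev : ∀ i → cycleG r i (prev i) ≡ true
  adj-prev i = trans (Bool.∨-comm (toℕ (prev i) ≡ᵇ nextMod r i) (toℕ i ≡ᵇ nextMod r (prev i)))
                     (subst (λ j → cycleG r (prev i) j ≡ true) (next-prev i) (adj-next (prev i)))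

  adj⇒next⊎prev : ∀ {i j} → cycleG r i j ≡ true → j ≡ next i ⊎ j ≡ prev i
  adj⇒next⊎prev {i} {j} e with toℕ j ≡ᵇ nextMod r i | ≡ᵇ-reflects (toℕ j) (nextMod r i)
  ... | true | ofʸ j≡ = inj₁ (toℕ-injective (trans j≡ (sym (toℕ-next i))))
  ... | false | _ = inj₂ (trans (sym (prev-next j)) (cong prev (sym i≡next-j)))
    where
    i≡next-j : i ≡ next j
    i≡next-j = toℕ-injective (trans (≡ᵇ-true⇒≡ e) (sym (toℕ-next j)))

  open Corona₂ (cycleG r)

  centre-adj⇒ᶜ : ∀ {w x} → C∘2K1 r (centre w) x ≡ true →
                 x ≡ centre (next w) ⊎ x ≡ centre (prev w) ⊎ ∃[ a ] x ≡ leaf w a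
  centre-adj⇒ᶜ {w} e with centre-adj⇒ e
  ... | inj₂ is-leaf = inj₂ (inj₂ is-leaf)
  ... | inj₁ (j , wj , refl) with adj⇒next⊎prev {w} {j} wj
  ...   | inj₁ refl = inj₁ refl
  ...   | inj₂ refl = inj₂ (inj₁ refl)

  fort-pass : ∀ {F w} → IsFort (C∘2K1 r) F → centre w ∉ F → (∀ a → leaf w a ∉ F) →
              centre (prev w) ∈ F → centre (next w) ∈ F
  fort-pass {w = w} fort c∉F leaves∉F p∈F
    with fort-second-neighbour (C∘2K1 r) fort c∉F p∈F (trans (centre-adj-centre w (prev w)) (adj-prev w))
  ... | x , wx , x≢p , x∈F with centre-adj⇒ᶜ {w} {x} wx
  ...   | inj₁ refl = x∈F
  ...   | inj₂ (inj₁ refl) = contradiction refl x≢p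
  ...   | inj₂ (inj₂ (a , refl)) = contradiction x∈F (leaves∉F a)

  fort-escape : ∀ {F w} → IsFort (C∘2K1 r) F → centre w ∉ F → leaf w 0F ∈ F → leaf w 1F ∉ F →
                centre (next w) ∈ F ⊎ centre (prev w) ∈ F
  fort-escape {w = w} fort c∉F l₀∈F l₁∉F
    with fort-second-neighbour (C∘2K1 r) fort c∉F l₀∈F (centre-adj-leaf {w} {0F})
  ... | x , wx , x≢l₀ , x∈F with centre-adj⇒ᶜ {w} {x} wx
  ...   | inj₁ refl = inj₁ x∈F
  ...   | inj₂ (inj₁ refl) = inj₂ x∈F
  ...   | inj₂ (inj₂ (0F , refl)) = contradiction refl x≢l₀
  ...   | inj₂ (inj₂ (1F , refl)) = contradiction x∈F l₁∉F

  module ZIrBound {S : Subset (r * 3)} (zir : IsZIrSet (C∘2K1 r) S) where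

    Vacant : Fin r → Set
    Vacant u = ∀ (j : Fin 3) → combine u j ∉ S

    vacant? : Decidable Vacant
    vacant? u = all? (λ j → ¬? (combine u j ∈? S))

    ForwardWitness : Fin r → Subset r → Set
    ForwardWitness v C = next v ∈ C × (∀ u → u ∈ C → Vacant u) ×
                         (∀ w → Double S w → w ≢ v → prev w ∈ C → next w ∈ C)

    Forward : Fin r → Set
    Forward v = ∃[ C ] ForwardWitness v C

    forward? : Decidable Forward
    forward? v = anySubset? {P = ForwardWitness v} λ C →
      next v ∈? C ×-dec
      all? (λ u → u ∈? C →-dec vacant? u) ×-dec
      all? (λ w → double? S w →-dec ¬? (w ≟ v) →-dec prev w ∈? C →-dec next w ∈? C)

    forward⇒vacant-next : ∀ {v} → Forward v → Vacant (next v)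
    forward⇒vacant-next (_ , next∈C , vacant , _) = vacant _ next∈C

    -- The only use of r ≥ 3: next i ≢ prev i.
    forward-step : ∀ {i} → Forward (prev i) → Double S (next i) → Forward (next i)
    forward-step {i} (C , i∈C , vacant , closed) double = C , next-next∈C , vacant , closed′
      where
      next-next∈C : next (next i) ∈ C
      next-next∈C = closed (next i) double (next≢prev i)
                      (subst (_∈ C) (trans (next-prev i) (sym (prev-next i))) i∈C)

      closed′ : ∀ w → Double S w → w ≢ next i → prev w ∈ C → next w ∈ C
      closed′ w double-w _ with w ≟ prev i
      ... | yes refl = const i∈C
      ... | no w≢prev = closed w double-w w≢prev

    module LeafFort {v} (double : Double S v) {F} (fort : IsFort (C∘2K1 r) F)
                    (S∩F≡ : S ∩ F ≡ ⁅ leaf v 0F ⁆) where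

      leaf₁∉F : leaf v 1F ∉ F
      leaf₁∉F l₁∈F
        with () ← proj₂ (leaf-injective {v} {v} {1F} {0F} (private-fort-unique S∩F≡ (proj₂ double) l₁∈F))

      centre∉F : centre v ∉ F
      centre∉F = leaf₁∉F ∘ fort-centre⇒leaf {F} {v} {1F} fort

      centre∈F⇒vacant : ∀ {u} → centre u ∈ F → Vacant u
      centre∈F⇒vacant {u} c∈F j x∈S
        with refl , _ ← combine-injective u j v 1F
                          (private-fort-unique S∩F≡ x∈S (fort-centre⇒block {F} {u} fort c∈F j))
        = centre∉F c∈F

      double-leaf∉F : ∀ {w} → Double S w → w ≢ v → ∀ a → leaf w a ∉ F
      double-leaf∉F {w} double-w w≢v a l∈F =
        w≢v (proj₁ (leaf-injective {w} {v} {a} {0F} (private-fort-unique S∩F≡ (l∈S a) l∈F)))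
        where
        l∈S : ∀ a → leaf w a ∈ S
        l∈S 0F = proj₁ double-w
        l∈S 1F = proj₂ double-w

      centres : Subset r
      centres = subset (λ u → centre u ∈? F)

      centres-∈⁺ : ∀ {u} → centre u ∈ F → u ∈ centres
      centres-∈⁺ = ∈-subset⁺ {P? = λ u → centre u ∈? F}

      centres-∈⁻ : ∀ {u} → u ∈ centres → centre u ∈ F
      centres-∈⁻ = ∈-subset⁻ {P? = λ u → centre u ∈? F}

      forward⊎vacant-prev : Forward v ⊎ Vacant (prev v)
      forward⊎vacant-prev =
        Sum.map forward (centre∈F⇒vacant {prev v})
                (fort-escape {F} {v} fort centre∉F (private-fort-∋ S∩F≡) leaf₁∉F)
        where
        closed : ∀ w → Double S w → w ≢ v → prev w ∈ centres → next w ∈ centres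
        closed w double-w w≢v prev∈C = centres-∈⁺ {next w} (fort-pass {F} {w} fort
          (double-leaf∉F double-w w≢v 0F ∘ fort-centre⇒leaf {F} {w} {0F} fort)
          (double-leaf∉F double-w w≢v) (centres-∈⁻ {prev w} prev∈C))

        forward : centre (next v) ∈ F → Forward v
        forward next∈F =
          centres , centres-∈⁺ {next v} next∈F , (λ u → centre∈F⇒vacant {u} ∘ centres-∈⁻ {u}) , closed

    double⇒forward⊎vacant-prev : ∀ {v} → Double S v → Forward v ⊎ Vacant (prev v)
    double⇒forward⊎vacant-prev {v} double =
      let F , fort , S∩F≡ = zir (leaf v 0F) (proj₁ double)
      in LeafFort.forward⊎vacant-prev double fort S∩F≡

    forwardCharge : Fin r → ℕ
    forwardCharge v = 𝟙 (does (double? S v ×-dec forward? v))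

    backwardCharge : Fin r → ℕ
    backwardCharge v = 𝟙 (does (double? S v ×-dec ¬? (forward? v)))

    discharge : ∀ i → blockSize S i + (forwardCharge (prev i) + backwardCharge (next i)) ≤
                      1 + (forwardCharge i + backwardCharge i)
    discharge i =
      by-cases (double? S (prev i) ×-dec forward? (prev i)) (double? S (next i) ×-dec ¬? (forward? (next i)))
      where
      own = forwardCharge i + backwardCharge i

      vacant-case : Vacant i → blockSize S i + 1 ≤ 1 + own
      vacant-case vacant =
        ℕ.≤-trans (ℕ.≤-reflexive (cong (_+ 1) (blockSize-vacant {S = S} {i} vacant))) (ℕ.m≤m+n 1 own)

      by-cases : (f? : Dec (Double S (prev i) × Forward (prev i)))
                 (b? : Dec (Double S (next i) × ¬ Forward (next i))) →
                 blockSize S i + (𝟙 (does f?) + 𝟙 (does b?)) ≤ 1 + own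
      by-cases (yes (_ , forward)) (yes (double , ¬forward)) =
        contradiction (forward-step forward double) ¬forward
      by-cases (yes (_ , forward)) (no _) =
        vacant-case (subst Vacant (next-prev i) (forward⇒vacant-next forward))
      by-cases (no _) (yes (double , ¬forward)) =
        [ flip contradiction ¬forward , vacant-case ∘ subst Vacant (prev-next i) ]′
          (double⇒forward⊎vacant-prev double)
      by-cases (no _) (no _) = begin
        blockSize S i + 0            ≡⟨ ℕ.+-identityʳ _ ⟩
        blockSize S i                ≤⟨ ZIr-blockSize≤ zir i ⟩
        1 + 𝟙 (does (double? S i))   ≡⟨ cong (1 +_) (sym (𝟙-split (double? S i) (forward? i))) ⟩
        1 + own                      ∎
        where open ℕ.≤-Reasoning

    ZIr-size≤ : ∣ S ∣ ≤ r
    ZIr-size≤ = begin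
      ∣ S ∣                   ≡⟨ ∣∣≡∑blockSize {r} S ⟩
      sum (blockSize {r} S)   ≤⟨ sum-≤-by-discharging prevπ nextπ (blockSize S) (λ _ → 1)
                                                       forwardCharge backwardCharge discharge ⟩
      sum {r} (λ _ → 1)       ≡⟨ sum-ones r ⟩
      r                       ∎
      where
      open ℕ.≤-Reasoning
      prevπ nextπ : Permutation′ r
      prevπ = permutation prev next prev-next next-prev
      nextπ = permutation next prev next-prev prev-next

  ZIR-C∘2K1 : ZIRIs (C∘2K1 r) r
  ZIR-C∘2K1 = (B₀ , (leaves-ZIr (const 0F) , maximal) , ∣leaves∣ (const 0F)) ,
              λ S (zir , _) → ZIrBound.ZIr-size≤ zir
    where
    B₀ = leaves (const 0F)

    maximal : ∀ S → B₀ ⊆ S → IsZIrSet (C∘2K1 r) S → S ≡ B₀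
    maximal S B₀⊆S zir =
      p⊆q∧∣q∣≤∣p∣⇒q≡p B₀⊆S (subst (∣ S ∣ ≤_) (sym (∣leaves∣ (const 0F))) (ZIrBound.ZIr-size≤ zir))

theorem5p11 : (r : ℕ) → 3 ≤ r →
    ZIs (C∘2K1 r) r × ZbarIs (C∘2K1 r) r × ZIRIs (C∘2K1 r) r × 3 * r ≡ r * 3
theorem5p11 (suc (suc (suc m))) (s≤s (s≤s (s≤s z≤n))) =
  Z-G∘2K1 , Zbar-G∘2K1 , ZIR-C∘2K1 , ℕ.*-comm 3 (3 + m)
  where
  open Cycle m
  open Corona₂ (cycleG r)
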